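{- Let $n\ge 2$ and let $Q_{4n}=\langle x,y: x^n=y^2, x^{2n}=y^4=e, y^{ -1}xy=x^{ -1}\rangle$ be the generalized quaternion group of order $4n$. Then $$\operatorname{sdim}(\mathcal{P}_R(Q_{4n}))=\begin{cases}2^{t+2}-t-1, & \text{if } n=2^t \text{ for some } t\ge1;\\ 4n-\Omega(2n)-1, & \text{otherwise.}\end{cases}$$
   Context: The reduced power graph $\mathcal{P}_R(G)$ of a finite group $G$ has vertex set $G$, two distinct vertices $x,y$ adjacent iff $\langle x\rangle\subsetneq\langle y\rangle$ or $\langle y\rangle\subsetneq\langle x\rangle$. $\Omega(m)$ is the number of prime factors of $m$ counted with multiplicity. For a graph $\Gamma$ and vertices $x,y,z$, $z$ strongly resolves $x$ and $y$ if there is a shortest path from $z$ to $x$ containing $y$ or a shortest path from $z$ to $y$ containing $x$; a strong resolving set is a vertex set $S$ such that every pair of distinct vertices is strongly resolved by some vertex of $S$; $\operatorname{sdim}(\Gamma)$ is the minimum size of a strong resolving set. -}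

module Defs where

open import Level using (Level; _⊔_) renaming (suc to lsuc)
open import Data.Nat using (ℕ; zero; suc; _+_; _*_; _∸_; _^_; _≤_; _<_; NonZero)
open import Data.Nat.DivMod using (_%_; m%n<n)
open import Data.Nat.Primality using (Prime)
open import Data.Fin using (Fin; toℕ; fromℕ<)
open import Data.Bool using (Bool; true; false)
open import Data.Product using (Σ; ∃; ∃-syntax; _×_; _,_)
open import Data.Sum using (_⊎_)
open import Data.List using (List; []; _∷_; length)
open import Data.Nat.ListAction using (product)
open import Data.List.Relation.Unary.All using (All)
open import Data.List.Membership.Propositional using (_∈_)
open import Data.List.Relation.Unary.Unique.Propositional using (Unique)
open import Relation.Binary.PropositionalEquality using (_≡_; _≢_)
open import Relation.Nullary using (¬_)

data Walk {a b} {V : Set a} (E : V → V → Set b) : V → V → Set (a ⊔ b) where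
  []  : ∀ {u} → Walk E u u
  _∷_ : ∀ {u v w} → E u v → Walk E v w → Walk E u w

walkLength : ∀ {a b} {V : Set a} {E : V → V → Set b} {u v : V} → Walk E u v → ℕ
walkLength []      = zero
walkLength (_ ∷ w) = suc (walkLength w)

walkVertices : ∀ {a b} {V : Set a} {E : V → V → Set b} {u v : V} → Walk E u v → List V
walkVertices {u = u} []      = u ∷ []
walkVertices {u = u} (_ ∷ w) = u ∷ walkVertices w

-- a shortest walk (= shortest path) from u to v
IsShortest : ∀ {a b} {V : Set a} {E : V → V → Set b} {u v : V} → Walk E u v → Set (a ⊔ b)
IsShortest {E = E} {u} {v} w = ∀ (w' : Walk E u v) → walkLength w ≤ walkLength w'

ShortestVia : ∀ {a b} {V : Set a} (E : V → V → Set b) (z x y : V) → Set (a ⊔ b)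
ShortestVia E z x y = Σ (Walk E z x) λ w → IsShortest w × (y ∈ walkVertices w)

StronglyResolves : ∀ {a b} {V : Set a} (E : V → V → Set b) (z x y : V) → Set (a ⊔ b)
StronglyResolves E z x y = ShortestVia E z x y ⊎ ShortestVia E z y x

IsStrongResolvingSet : ∀ {a b} {V : Set a} (E : V → V → Set b) → List V → Set (a ⊔ b)
IsStrongResolvingSet {V = V} E S =
  ∀ (x y : V) → x ≢ y → ∃[ z ] (z ∈ S × StronglyResolves E z x y)

SDimIs : ∀ {a b} {V : Set a} (E : V → V → Set b) → ℕ → Set (a ⊔ b)
SDimIs {V = V} E k =
  (∃[ S ] (Unique S × IsStrongResolvingSet E S × length S ≡ k))
  × (∀ (S : List V) → Unique S → IsStrongResolvingSet E S → k ≤ length S)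

pow : ∀ {a} {G : Set a} → (G → G → G) → G → G → ℕ → G
pow _·_ e g zero    = e
pow _·_ e g (suc k) = g · pow _·_ e g k

InCyclic : ∀ {a} {G : Set a} → (G → G → G) → G → G → G → Set a
InCyclic _·_ e h g = ∃[ k ] (h ≡ pow _·_ e g k)

ProperCyclic : ∀ {a} {G : Set a} → (G → G → G) → G → G → G → Set a
ProperCyclic _·_ e g h = InCyclic _·_ e g h × ¬ InCyclic _·_ e h g

ReducedPowerAdj : ∀ {a} {G : Set a} → (G → G → G) → G → G → G → Set a
ReducedPowerAdj _·_ e g h = g ≢ h × (ProperCyclic _·_ e g h ⊎ ProperCyclic _·_ e h g)

-- The generalized quaternion group Q_{4n}, concretely:
-- the element (i , b) stands for x^i y^b  (i mod 2n, b ∈ {0,1}), with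
--   x^i · x^j       = x^(i+j)
--   x^i · x^j y     = x^(i+j) y
--   x^i y · x^j     = x^(i-j) y
--   x^i y · x^j y   = x^(i-j+n)        (since y^2 = x^n)
-- so x = (1 , false), y = (0 , true) satisfy x^n = y^2, x^(2n) = y^4 = e,
-- y^(-1) x y = x^(-1).

QElem : ℕ → Set
QElem n = Fin (n + n) × Bool

red : (n : ℕ) → .{{NonZero n}} → ℕ → Fin (n + n)
red (suc k) a = fromℕ< (m%n<n a (suc k + suc k))

qMul : (n : ℕ) → .{{NonZero n}} → QElem n → QElem n → QElem n
qMul n (i , false) (j , false) = red n (toℕ i + toℕ j) , false
qMul n (i , false) (j , true)  = red n (toℕ i + toℕ j) , true
qMul n (i , true)  (j , false) = red n (toℕ i + ((n + n) ∸ toℕ j)) , true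
qMul n (i , true)  (j , true)  = red n (toℕ i + ((n + n) ∸ toℕ j) + n) , false

qId : (n : ℕ) → .{{NonZero n}} → QElem n
qId n = red n 0 , false

QAdj : (n : ℕ) → .{{NonZero n}} → QElem n → QElem n → Set
QAdj n = ReducedPowerAdj (qMul n) (qId n)

OmegaIs : ℕ → ℕ → Set
OmegaIs m k = ∃[ ps ] (All Prime ps × length ps ≡ k × product ps ≡ m)

-- The identity e is adjacent to every other vertex of P_R(Q_4n), so the graph has
-- diameter at most 2. Then two non-adjacent vertices, or two twins, can only be strongly
-- resolved by one of themselves, so the vertices outside a strong resolving set form a
-- clique without twins. The elements x^i y are pairwise non-adjacent and adjacent to x^j
-- only for x^j ∈ {e, xⁿ}; labelling x^i by Ω(gcd(i, 2n)) and x^i y by 0 is therefore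
-- injective on a clique, which thus has at most Ω(2n) + 1 elements. When n = 2^t the
-- vertices e and xⁿ are twins, and identifying them saves one more label. Conversely, for
-- a maximal chain of divisors d of 2n (of n when n = 2^t) the elements x^d form a clique
-- in which x^(2n − d') separates x^d from x^d' whenever d' ∣ d, so its complement is a
-- strong resolving set of the required size.
module Submission where

open import Defs
open import Data.Nat
  using (ℕ; zero; suc; _+_; _*_; _∸_; _^_; _≤_; _<_; NonZero; >-nonZero; >-nonZero⁻¹; nonTrivial⇒n>1; z≤n; s≤s)
import Data.Nat as ℕ
open import Data.Nat.Properties hiding (_≟_)
open import Data.Nat.Divisibility
open import Data.Nat.DivMod
open import Data.Nat.GCD
open import Data.Nat.Tactic.RingSolver using (solve-∀)
open import Data.Nat.Coprimality using (Coprime; coprime-divisor)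
open import Data.Nat.Primality
  using (Prime; prime⇒irreducible; prime⇒nonZero; prime⇒nonTrivial; prime[2]; productOfPrimes≢0)
open import Data.Nat.ListAction using (product)
open import Data.Product using (Σ; ∃-syntax; _×_; _,_; proj₁; proj₂)
open import Data.Product.Properties using (≡-dec)
open import Data.Sum using (_⊎_; inj₁; inj₂; [_,_]; swap)
open import Data.Empty using (⊥; ⊥-elim)
open import Function using (_∘_)
open import Data.Fin using (Fin; toℕ)
import Data.Fin.Properties as Fin
import Data.Bool.Properties as Bool
open import Data.Fin.Properties using (toℕ-fromℕ<; toℕ-injective; toℕ<n)
open import Data.Bool using (Bool; true; false)
open import Data.List using (List; []; _∷_; length; filter; upTo; map; _++_; allFin; replicate)
open import Data.List.Properties using (length-upTo; length-++; length-map; length-tabulate; length-replicate)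
open import Data.List.Membership.Propositional using (_∈_; _∉_)
open import Data.List.Membership.Propositional.Properties
  using (∈-filter⁺; ∈-filter⁻; ∈-upTo⁺; ∈-map⁺; ∈-map⁻; ∈-++⁺ˡ; ∈-++⁺ʳ; ∈-allFin)
open import Data.List.Relation.Unary.Any using (here; there)
open import Data.List.Relation.Unary.All using (All; []; _∷_)
import Data.List.Relation.Unary.All as All
import Data.List.Relation.Unary.All.Properties as All
open import Data.List.Relation.Unary.AllPairs using ([]; _∷_)
open import Data.List.Relation.Unary.Unique.Propositional using (Unique)
import Data.List.Relation.Unary.Unique.Propositional.Properties as Unique
open import Level using (0ℓ)
open import Relation.Binary.Core using (Rel)
open import Relation.Binary.Definitions using (DecidableEquality; Symmetric)
open import Relation.Binary.PropositionalEquality hiding ([_])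
open import Relation.Nullary using (¬_; Dec; yes; no; ¬?)
open import Relation.Nullary.Decidable using (_×-dec_; _⊎-dec_; map′)
open import Relation.Unary using (Pred; Decidable)
open import Relation.Unary.Properties using (∁?)

∈-remove : ∀ {A : Set} {y : A} {ys : List A} → y ∈ ys →
  ∃[ zs ] (length ys ≡ suc (length zs) × (∀ {z} → z ∈ ys → z ≢ y → z ∈ zs))
∈-remove {ys = _ ∷ ys} (here refl) =
  ys , refl , λ { (here refl) z≢y → ⊥-elim (z≢y refl) ; (there z∈) _ → z∈ }
∈-remove {ys = y ∷ _} (there y∈) with ∈-remove y∈
... | zs , len , keep =
  y ∷ zs , cong suc len , λ { (here refl) _ → here refl ; (there z∈) z≢y → there (keep z∈ z≢y) }

pigeonhole : ∀ {A B : Set} {xs : List A} (ys : List B) (f : A → B) → Unique xs →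
  (∀ {a b} → a ∈ xs → b ∈ xs → a ≢ b → f a ≢ f b) →
  (∀ {a} → a ∈ xs → f a ∈ ys) → length xs ≤ length ys
pigeonhole ys f [] _ _ = z≤n
pigeonhole {xs = x ∷ xs} ys f (x∉xs ∷ unique) injective into with ∈-remove (into (here refl))
... | zs , len , keep = subst (suc (length xs) ≤_) (sym len)
  (s≤s (pigeonhole zs f unique (λ a∈ b∈ → injective (there a∈) (there b∈))
    (λ a∈ → keep (into (there a∈)) (injective (there a∈) (here refl) (a≢x a∈)))))
  where
  a≢x : ∀ {a} → a ∈ xs → a ≢ x
  a≢x a∈ refl = All.lookup x∉xs a∈ refl

unique-map⁺ : ∀ {A B : Set} {f : A → B} {xs : List A} → Unique xs →
  (∀ {a b} → a ∈ xs → b ∈ xs → f a ≡ f b → a ≡ b) → Unique (map f xs)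
unique-map⁺ [] _ = []
unique-map⁺ {xs = x ∷ xs} (x∉xs ∷ unique) injective =
  All.map⁺ (All.tabulate (λ a∈ fx≡fa → All.lookup x∉xs a∈ (injective (here refl) (there a∈) fx≡fa)))
  ∷ unique-map⁺ unique (λ a∈ b∈ → injective (there a∈) (there b∈))

length-filter+filter-∁ : ∀ {A : Set} {P : Pred A 0ℓ} (P? : Decidable P) (xs : List A) →
  length (filter P? xs) + length (filter (∁? P?) xs) ≡ length xs
length-filter+filter-∁ P? [] = refl
length-filter+filter-∁ P? (x ∷ xs) with P? x
... | yes _ = cong suc (length-filter+filter-∁ P? xs)
... | no _ = trans (+-suc _ _) (cong suc (length-filter+filter-∁ P? xs))

-- Strong resolving sets in graphs with a universal vertex

SDimIs-intro : ∀ {V : Set} {E : Rel V 0ℓ} M L →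
  ∃[ S ] (Unique S × IsStrongResolvingSet E S × length S ≡ M ∸ suc L) →
  (∀ S → Unique S → IsStrongResolvingSet E S → M ≤ suc L + length S) →
  SDimIs E (M ∸ L ∸ 1)
SDimIs-intro M L (S , unique , resolving , length-S) lower =
  (S , unique , resolving , trans length-S M∸[1+L]) ,
  λ S′ unique′ resolving′ →
    subst (_≤ length S′) M∸[1+L] (m≤n+o⇒m∸n≤o M (suc L) (lower S′ unique′ resolving′))
  where
  M∸[1+L] : M ∸ suc L ≡ M ∸ L ∸ 1
  M∸[1+L] = sym (trans (∸-+-assoc M L 1) (cong (M ∸_) (+-comm L 1)))

module UniversalVertex {V : Set} (E : Rel V 0ℓ) (_≟_ : DecidableEquality V)
    (E? : ∀ u v → Dec (E u v)) (E-sym : Symmetric E)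
    (hub : V) (hub-adj : ∀ v → v ≢ hub → E hub v) where

  open import Data.List.Membership.DecPropositional _≟_ using (_∈?_)

  walkLength≥1 : ∀ {u v} → u ≢ v → (w : Walk E u v) → 1 ≤ walkLength w
  walkLength≥1 u≢v [] = ⊥-elim (u≢v refl)
  walkLength≥1 u≢v (_ ∷ _) = s≤s z≤n

  walkLength≥2 : ∀ {u v} → u ≢ v → ¬ E u v → (w : Walk E u v) → 2 ≤ walkLength w
  walkLength≥2 u≢v _ [] = ⊥-elim (u≢v refl)
  walkLength≥2 _ ¬uv (uv ∷ []) = ⊥-elim (¬uv uv)
  walkLength≥2 _ _ (_ ∷ _ ∷ _) = s≤s (s≤s z≤n)

  via-hub : ∀ {u v} → u ≢ hub → v ≢ hub → Walk E u v
  via-hub u≢hub v≢hub = E-sym (hub-adj _ u≢hub) ∷ hub-adj _ v≢hub ∷ []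

  walk≤2 : ∀ u v → Σ (Walk E u v) λ w → walkLength w ≤ 2
  walk≤2 u v with u ≟ v | u ≟ hub | v ≟ hub
  ... | yes refl | _ | _ = [] , z≤n
  ... | no u≢v | yes refl | _ = hub-adj v (λ v≡u → u≢v (sym v≡u)) ∷ [] , s≤s z≤n
  ... | no _ | no u≢hub | yes refl = E-sym (hub-adj u u≢hub) ∷ [] , s≤s z≤n
  ... | no _ | no u≢hub | no v≢hub = via-hub u≢hub v≢hub , ≤-refl

  shortestWalk : ∀ u v → Σ (Walk E u v) IsShortest
  shortestWalk u v with u ≟ v | E? u v
  ... | yes refl | _ = [] , λ _ → z≤n
  ... | no u≢v | yes uv = uv ∷ [] , walkLength≥1 u≢v
  ... | no u≢v | no ¬uv with u ≟ hub | v ≟ hub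
  ... | yes refl | _ = ⊥-elim (¬uv (hub-adj v (λ v≡u → u≢v (sym v≡u))))
  ... | no u≢hub | yes refl = ⊥-elim (¬uv (E-sym (hub-adj u u≢hub)))
  ... | no u≢hub | no v≢hub = via-hub u≢hub v≢hub , walkLength≥2 u≢v ¬uv

  source∈walkVertices : ∀ {u v} (w : Walk E u v) → u ∈ walkVertices w
  source∈walkVertices [] = here refl
  source∈walkVertices (_ ∷ _) = here refl

  shortestVia-source : ∀ x y → ShortestVia E x y x
  shortestVia-source x y with shortestWalk x y
  ... | w , shortest = w , shortest , source∈walkVertices w

  shortest-predecessor : ∀ {z x y} (p : Walk E z x) → IsShortest p → y ∈ walkVertices p →
    y ≡ z ⊎ ∃[ w ] (E w y × Σ (Walk E y x) λ r → ∀ (s : Walk E w x) → suc (walkLength r) ≤ walkLength s)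
  shortest-predecessor [] _ (here refl) = inj₁ refl
  shortest-predecessor (_ ∷ _) _ (here refl) = inj₁ refl
  shortest-predecessor {z} (zv ∷ p) shortest (there y∈) with
    shortest-predecessor p (λ s → ≤-pred (shortest (zv ∷ s))) y∈
  ... | inj₁ refl = inj₂ (z , zv , p , shortest)
  ... | inj₂ found = inj₂ found

  ¬shortestVia-nonAdjacent : ∀ {z x y} → z ≢ y → x ≢ y → ¬ E x y → ¬ ShortestVia E z x y
  ¬shortestVia-nonAdjacent z≢y x≢y ¬xy (p , shortest , y∈) with shortest-predecessor p shortest y∈
  ... | inj₁ y≡z = z≢y (sym y≡z)
  ... | inj₂ (w , _ , r , longer) with walk≤2 w _
  ... | s , s≤2 =
    3≰2 (≤-trans (s≤s (walkLength≥2 (≢-sym x≢y) (λ yx → ¬xy (E-sym yx)) r)) (≤-trans (longer s) s≤2))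
    where
    3≰2 : ¬ (3 ≤ 2)
    3≰2 (s≤s (s≤s ()))

  Twin : V → V → Set
  Twin x y = ∀ w → E w y → w ≡ x ⊎ E w x

  ¬shortestVia-twin : ∀ {z x y} → z ≢ y → x ≢ y → Twin x y → ¬ ShortestVia E z x y
  ¬shortestVia-twin z≢y x≢y twin (p , shortest , y∈) with shortest-predecessor p shortest y∈
  ... | inj₁ y≡z = z≢y (sym y≡z)
  ... | inj₂ (w , wy , r , longer) with twin w wy
  ... | inj₁ refl with longer []
  ... | ()
  ¬shortestVia-twin z≢y x≢y twin (p , shortest , y∈) | inj₂ (w , wy , r , longer) | inj₂ wx =
    2≰1 (≤-trans (s≤s (walkLength≥1 (≢-sym x≢y) r)) (longer (wx ∷ [])))
    where
    2≰1 : ¬ (2 ≤ 1)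
    2≰1 (s≤s ())

  module ResolvingSet (S : List V) (resolving : IsStrongResolvingSet E S) where

    ∈∧∉⇒≢ : ∀ {z v} → z ∈ S → v ∉ S → z ≢ v
    ∈∧∉⇒≢ z∈ v∉ refl = v∉ z∈

    outside-adjacent : ∀ {x y} → x ∉ S → y ∉ S → x ≢ y → E x y
    outside-adjacent {x} {y} x∉ y∉ x≢y with E? x y
    ... | yes xy = xy
    ... | no ¬xy with resolving x y x≢y
    ... | z , z∈ , inj₁ via = ⊥-elim (¬shortestVia-nonAdjacent (∈∧∉⇒≢ z∈ y∉) x≢y ¬xy via)
    ... | z , z∈ , inj₂ via =
      ⊥-elim (¬shortestVia-nonAdjacent (∈∧∉⇒≢ z∈ x∉) (≢-sym x≢y) (λ yx → ¬xy (E-sym yx)) via)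

    outside-¬twins : ∀ {x y} → x ∉ S → y ∉ S → x ≢ y → Twin x y → Twin y x → ⊥
    outside-¬twins {x} {y} x∉ y∉ x≢y twin-xy twin-yx with resolving x y x≢y
    ... | z , z∈ , inj₁ via = ¬shortestVia-twin (∈∧∉⇒≢ z∈ y∉) x≢y twin-xy via
    ... | z , z∈ , inj₂ via = ¬shortestVia-twin (∈∧∉⇒≢ z∈ x∉) (≢-sym x≢y) twin-yx via

  Separates : V → V → V → Set
  Separates w a b = E w a × ¬ E w b × w ≢ b

  module Complement (vertices : List V) (unique : Unique vertices) (complete : ∀ v → v ∈ vertices) where

    complement : List V → List V
    complement C = filter (∁? (_∈? C)) vertices

    ∈-complement : ∀ {C v} → v ∉ C → v ∈ complement C
    ∈-complement {C} {v} v∉ = ∈-filter⁺ (∁? (_∈? C)) (complete v) v∉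

    complement-unique : ∀ C → Unique (complement C)
    complement-unique C = Unique.filter⁺ (∁? (_∈? C)) unique

    ∈-complement⁻ : ∀ {C v} → v ∈ complement C → v ∉ C
    ∈-complement⁻ {C} v∈ = proj₂ (∈-filter⁻ (∁? (_∈? C)) {xs = vertices} v∈)

    length-complement : ∀ C → Unique C → length (complement C) + length C ≡ length vertices
    length-complement C uniqueC = begin
      length (complement C) + length C                     ≡⟨ +-comm (length (complement C)) _ ⟩
      length C + length (complement C)                     ≡⟨ cong (_+ length (complement C)) (sym length-C) ⟩
      length (filter (_∈? C) vertices) + length (complement C) ≡⟨ length-filter+filter-∁ (_∈? C) vertices ⟩
      length vertices                                      ∎
      where
      open ≡-Reasoning
      length-C : length (filter (_∈? C) vertices) ≡ length C
      length-C = ≤-antisym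
        (pigeonhole C (λ v → v) (Unique.filter⁺ (_∈? C) unique) (λ _ _ a≢b → a≢b)
          (λ v∈ → proj₂ (∈-filter⁻ (_∈? C) {xs = vertices} v∈)))
        (pigeonhole (filter (_∈? C) vertices) (λ v → v) uniqueC (λ _ _ a≢b → a≢b)
          (λ {v} v∈C → ∈-filter⁺ (_∈? C) (complete v) v∈C))

    length-vertices-≤ : ∀ S L (label : V → ℕ) → Unique S → (∀ v → label v ≤ L) →
      (∀ {a b} → a ∉ S → b ∉ S → a ≢ b → label a ≢ label b) →
      length vertices ≤ suc L + length S
    length-vertices-≤ S L label uniqueS bounded injective = begin
      length vertices                        ≡⟨ sym (length-complement S uniqueS) ⟩
      length (complement S) + length S       ≤⟨ +-monoˡ-≤ (length S) length-complement≤ ⟩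
      suc L + length S                       ∎
      where
      open ≤-Reasoning
      length-complement≤ : length (complement S) ≤ suc L
      length-complement≤ = subst (length (complement S) ≤_) (length-upTo (suc L))
        (pigeonhole (upTo (suc L)) label (complement-unique S)
          (λ a∈ b∈ → injective (∈-complement⁻ a∈) (∈-complement⁻ b∈))
          (λ {a} _ → ∈-upTo⁺ (s≤s (bounded a))))

    -- The separating vertex lies outside C because C is a clique.
    complement-resolving : ∀ C →
      (∀ {a b} → a ∈ C → b ∈ C → a ≢ b → E a b × (∃[ w ] Separates w a b ⊎ ∃[ w ] Separates w b a)) →
      IsStrongResolvingSet E (complement C)
    complement-resolving C separated x y x≢y with x ∈? C | y ∈? C
    ... | no x∉ | _ = x , ∈-complement x∉ , inj₂ (shortestVia-source x y)
    ... | yes _ | no y∉ = y , ∈-complement y∉ , inj₁ (shortestVia-source y x)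
    ... | yes x∈ | yes y∈ with separated x∈ y∈ x≢y
    ... | xy , inj₁ (w , wx , ¬wy , w≢y) =
      w , ∈-complement (λ w∈ → ¬wy (proj₁ (separated w∈ y∈ w≢y))) ,
      inj₂ (wx ∷ xy ∷ [] , walkLength≥2 w≢y ¬wy , there (here refl))
    ... | xy , inj₂ (w , wy , ¬wx , w≢x) =
      w , ∈-complement (λ w∈ → ¬wx (proj₁ (separated w∈ x∈ w≢x))) ,
      inj₁ (wy ∷ E-sym xy ∷ [] , walkLength≥2 w≢x ¬wx , there (here refl))

-- Divisor chains, prime factor counts and residues

product-replicate : ∀ k m → product (replicate k m) ≡ m ^ k
product-replicate zero m = refl
product-replicate (suc k) m = cong (m *_) (product-replicate k m)

suffixProducts : List ℕ → List ℕ
suffixProducts [] = 1 ∷ []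
suffixProducts (p ∷ ps) = product (p ∷ ps) ∷ suffixProducts ps

length-suffixProducts : ∀ ps → length (suffixProducts ps) ≡ suc (length ps)
length-suffixProducts [] = refl
length-suffixProducts (p ∷ ps) = cong suc (length-suffixProducts ps)

suffixProducts-∣ : ∀ ps {d} → d ∈ suffixProducts ps → d ∣ product ps
suffixProducts-∣ [] (here refl) = ∣-refl
suffixProducts-∣ (p ∷ ps) (here refl) = ∣-refl
suffixProducts-∣ (p ∷ ps) (there d∈) = ∣n⇒∣m*n p (suffixProducts-∣ ps d∈)

suffixProducts-comparable : ∀ ps {d d'} → d ∈ suffixProducts ps → d' ∈ suffixProducts ps → d ∣ d' ⊎ d' ∣ d
suffixProducts-comparable [] (here refl) (here refl) = inj₁ ∣-refl
suffixProducts-comparable (p ∷ ps) (here refl) (here refl) = inj₁ ∣-refl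
suffixProducts-comparable (p ∷ ps) (here refl) (there d'∈) = inj₂ (suffixProducts-∣ (p ∷ ps) (there d'∈))
suffixProducts-comparable (p ∷ ps) (there d∈) (here refl) = inj₁ (suffixProducts-∣ (p ∷ ps) (there d∈))
suffixProducts-comparable (p ∷ ps) (there d∈) (there d'∈) = suffixProducts-comparable ps d∈ d'∈

suffixProducts-unique : ∀ {ps} → All Prime ps → Unique (suffixProducts ps)
suffixProducts-unique {[]} _ = [] ∷ []
suffixProducts-unique {p ∷ ps} (p-prime ∷ primes) = All.tabulate head≢ ∷ suffixProducts-unique primes
  where
  instance
    _ : NonZero (product ps)
    _ = productOfPrimes≢0 primes
  head≢ : ∀ {d} → d ∈ suffixProducts ps → p * product ps ≢ d
  head≢ d∈ refl = <⇒≱ (subst (product ps <_) (*-comm (product ps) p)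
      (m<m*n (product ps) p (nonTrivial⇒n>1 p {{prime⇒nonTrivial p-prime}})))
    (∣⇒≤ (suffixProducts-∣ ps d∈))

-- For d dividing product ps (ps a list of primes) this is Ω(d): every prime of ps
-- dividing what is left of d is peeled off and counted.
primeCount : List ℕ → ℕ → ℕ
primeCount [] d = 0
primeCount (p ∷ ps) d with p ∣? d
... | yes (divides q _) = suc (primeCount ps q)
... | no _ = primeCount ps d

prime∤⇒coprime : ∀ {p d} → Prime p → ¬ p ∣ d → Coprime d p
prime∤⇒coprime p-prime p∤d (c∣d , c∣p) with prime⇒irreducible p-prime c∣p
... | inj₁ c≡1 = c≡1
... | inj₂ refl = ⊥-elim (p∤d c∣d)

prime∤-cancelˡ : ∀ {p d m} → Prime p → ¬ p ∣ d → d ∣ p * m → d ∣ m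
prime∤-cancelˡ p-prime p∤d = coprime-divisor (prime∤⇒coprime p-prime p∤d)

m*p∣p*n⇒m∣n : ∀ {p m n} → Prime p → m * p ∣ p * n → m ∣ n
m*p∣p*n⇒m∣n {p} {m} {n} p-prime mp∣pn =
  *-cancelʳ-∣ p {{prime⇒nonZero p-prime}} (subst (m * p ∣_) (*-comm p n) mp∣pn)

prime∤-cancelʳ : ∀ {p d q} → Prime p → ¬ p ∣ d → d ∣ q * p → d ∣ q
prime∤-cancelʳ {p} {d} {q} p-prime p∤d d∣qp = prime∤-cancelˡ p-prime p∤d (subst (d ∣_) (*-comm q p) d∣qp)

primeCount-mono : ∀ {ps d e} → All Prime ps → d ∣ e → e ∣ product ps → primeCount ps d ≤ primeCount ps e
primeCount-mono {[]} _ _ _ = z≤n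
primeCount-mono {p ∷ ps} {d} {e} (p-prime ∷ primes) d∣e e∣ with p ∣? d | p ∣? e
... | yes (divides q₁ refl) | yes (divides q₂ refl) =
  s≤s (primeCount-mono primes (*-cancelʳ-∣ p {{prime⇒nonZero p-prime}} d∣e) (m*p∣p*n⇒m∣n p-prime e∣))
... | yes p∣d | no p∤e = ⊥-elim (p∤e (∣-trans p∣d d∣e))
... | no p∤d | yes (divides q₂ refl) =
  m≤n⇒m≤1+n (primeCount-mono primes (prime∤-cancelʳ p-prime p∤d d∣e) (m*p∣p*n⇒m∣n p-prime e∣))
... | no p∤d | no p∤e = primeCount-mono primes d∣e (prime∤-cancelˡ p-prime p∤e e∣)

primeCount-< : ∀ {ps d e} → All Prime ps → d ∣ e → ¬ e ∣ d → e ∣ product ps →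
  primeCount ps d < primeCount ps e
primeCount-< {[]} {d} _ _ e∤d e∣1 = ⊥-elim (e∤d (subst (_∣ d) (sym (∣1⇒≡1 e∣1)) (1∣ d)))
primeCount-< {p ∷ ps} {d} {e} (p-prime ∷ primes) d∣e e∤d e∣ with p ∣? d | p ∣? e
... | yes (divides q₁ refl) | yes (divides q₂ refl) =
  s≤s (primeCount-< primes (*-cancelʳ-∣ p {{prime⇒nonZero p-prime}} d∣e)
    (λ q₂∣q₁ → e∤d (*-monoˡ-∣ p q₂∣q₁)) (m*p∣p*n⇒m∣n p-prime e∣))
... | yes p∣d | no p∤e = ⊥-elim (p∤e (∣-trans p∣d d∣e))
... | no p∤d | yes (divides q₂ refl) =
  s≤s (primeCount-mono primes (prime∤-cancelʳ p-prime p∤d d∣e) (m*p∣p*n⇒m∣n p-prime e∣))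
... | no p∤d | no p∤e = primeCount-< primes d∣e e∤d (prime∤-cancelˡ p-prime p∤e e∣)

primeCount-product : ∀ {ps} → All Prime ps → primeCount ps (product ps) ≡ length ps
primeCount-product {[]} _ = refl
primeCount-product {p ∷ ps} (p-prime ∷ primes) with p ∣? p * product ps
... | yes (divides q eq) =
  cong suc (trans (cong (primeCount ps) q≡) (primeCount-product primes))
  where
  q≡ : q ≡ product ps
  q≡ = *-cancelʳ-≡ q (product ps) p {{prime⇒nonZero p-prime}} (trans (sym eq) (*-comm p (product ps)))
... | no p∤ = ⊥-elim (p∤ (m∣m*n (product ps)))

primeCount-≤-length : ∀ {ps d} → All Prime ps → d ∣ product ps → primeCount ps d ≤ length ps
primeCount-≤-length {ps} {d} primes d∣ =
  subst (primeCount ps d ≤_) (primeCount-product primes) (primeCount-mono primes d∣ ∣-refl)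

[m+kn]≡[o+ln]⇒m%n≡o%n : ∀ n .{{_ : NonZero n}} m o k l → m + k * n ≡ o + l * n → m % n ≡ o % n
[m+kn]≡[o+ln]⇒m%n≡o%n n m o k l eq =
  trans (sym ([m+kn]%n≡m%n m k n)) (trans (cong (_% n) eq) ([m+kn]%n≡m%n o l n))

gcd-multiple : ∀ i K → ∃[ a ] ((i * a) % suc K ≡ gcd i (suc K) % suc K)
gcd-multiple i K with Bézout.identity (gcd-GCD i (suc K))
... | Bézout.+- x y eq = x , [m+kn]≡[o+ln]⇒m%n≡o%n (suc K) (i * x) g 0 y
  (trans (trans (+-identityʳ (i * x)) (*-comm i x)) (sym eq))
  where
  g : ℕ
  g = gcd i (suc K)
-- Here g ≡ −x i, and −1 ≡ K modulo K + 1.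
... | Bézout.-+ x y eq = x * K , [m+kn]≡[o+ln]⇒m%n≡o%n (suc K) (i * (x * K)) g y (x * i) (begin
  i * (x * K) + y * suc K   ≡⟨ cong (i * (x * K) +_) (sym eq) ⟩
  i * (x * K) + (g + x * i) ≡⟨ regroup i x K g ⟩
  g + x * i * suc K         ∎)
  where
  open ≡-Reasoning
  g : ℕ
  g = gcd i (suc K)
  regroup : ∀ i x K g → i * (x * K) + (g + x * i) ≡ g + x * i * suc K
  regroup = solve-∀

multiple%⇒gcd∣ : ∀ N .{{_ : NonZero N}} i m → gcd i N ∣ (i * m) % N
multiple%⇒gcd∣ N i m = %-presˡ-∣ (∣m⇒∣m*n m (gcd[m,n]∣m i N)) (gcd[m,n]∣n i N)

gcd∣⇒multiple% : ∀ K i j → gcd i (suc K) ∣ j → j < suc K → ∃[ m ] (j ≡ (i * m) % suc K)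
gcd∣⇒multiple% K i j (divides c refl) j<N with gcd-multiple i K
... | a , ia≡g = a * c , sym (begin
  (i * (a * c)) % N               ≡⟨ cong (_% N) (sym (*-assoc i a c)) ⟩
  (i * a * c) % N                 ≡⟨ %-distribˡ-* (i * a) c N ⟩
  ((i * a) % N * (c % N)) % N     ≡⟨ cong (λ r → (r * (c % N)) % N) ia≡g ⟩
  (g % N * (c % N)) % N           ≡⟨ sym (%-distribˡ-* g c N) ⟩
  (g * c) % N                     ≡⟨ cong (_% N) (*-comm g c) ⟩
  (c * g) % N                     ≡⟨ m<n⇒m%n≡m j<N ⟩
  c * g                           ∎)
  where
  open ≡-Reasoning
  N g : ℕ
  N = suc K
  g = gcd i N

gcd[d%N,N]≡d : ∀ N .{{_ : NonZero N}} d → d ∣ N → gcd (d % N) N ≡ d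
gcd[d%N,N]≡d N d d∣N = GCD.unique (gcd-GCD (d % N) N)
  (GCD.is (%-presˡ-∣ ∣-refl d∣N , d∣N) (λ (c∣d%N , c∣N) → ∣n∣m%n⇒∣m c∣N c∣d%N))

∣N⇒∣N∸d : ∀ {c d N} → d ≤ N → c ∣ N → c ∣ d → c ∣ N ∸ d
∣N⇒∣N∸d {c} {d} {N} d≤N c∣N c∣d = ∣m+n∣m⇒∣n (subst (c ∣_) (sym (m+[n∸m]≡n d≤N)) c∣N) c∣d

gcd[[N∸d]%N,N]≡d : ∀ N .{{_ : NonZero N}} d → d ∣ N → d ≤ N → gcd ((N ∸ d) % N) N ≡ d
gcd[[N∸d]%N,N]≡d N d d∣N d≤N = GCD.unique (gcd-GCD ((N ∸ d) % N) N)
  (GCD.is (%-presˡ-∣ (∣N⇒∣N∸d d≤N d∣N ∣-refl) d∣N , d∣N)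
          (λ (c∣ , c∣N) → ∣m+n∣m⇒∣n (subst (_ ∣_) (sym (m∸n+n≡m d≤N)) c∣N) (∣n∣m%n⇒∣m c∣N c∣)))

∣p^[1+t]⇒∣p^t : ∀ {p} t {d} → Prime p → d ∣ p ^ suc t → d ≢ p ^ suc t → d ∣ p ^ t
∣p^[1+t]⇒∣p^t {p} t {d} p-prime d∣ d≢ with p ∣? d
... | no p∤d = prime∤-cancelˡ p-prime p∤d d∣
∣p^[1+t]⇒∣p^t {p} zero p-prime d∣ d≢ | yes (divides q refl) with ∣1⇒≡1 (m*p∣p*n⇒m∣n {p} {q} {1} p-prime d∣)
... | refl = ⊥-elim (d≢ (trans (*-identityˡ p) (sym (*-identityʳ p))))
∣p^[1+t]⇒∣p^t {p} (suc t) p-prime d∣ d≢ | yes (divides q refl) =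
  subst (q * p ∣_) (*-comm (p ^ t) p) (*-monoˡ-∣ p (∣p^[1+t]⇒∣p^t t {q} p-prime (m*p∣p*n⇒m∣n p-prime d∣)
    (λ q≡ → d≢ (trans (cong (_* p) q≡) (*-comm (p ^ suc t) p)))))

∣∧<⇒≡0 : ∀ {N d} → N ∣ d → d < N → d ≡ 0
∣∧<⇒≡0 (divides zero eq) _ = eq
∣∧<⇒≡0 {N} (divides (suc q) refl) d<N = ⊥-elim (<⇒≱ d<N (m≤m+n N (q * N)))

all≡2⇒product≡2^length : ∀ {ps} → All (_≡ 2) ps → product ps ≡ 2 ^ length ps
all≡2⇒product≡2^length [] = refl
all≡2⇒product≡2^length (refl ∷ all-2) = cong (2 *_) (all≡2⇒product≡2^length all-2)

odd-prime-factor : ∀ {ps} → All Prime ps → ¬ All (_≡ 2) ps →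
  ∃[ q ] ∃[ rest ] (Prime q × q ≢ 2 × All Prime rest ×
                    length ps ≡ suc (length rest) × product ps ≡ q * product rest)
odd-prime-factor [] ¬all-2 = ⊥-elim (¬all-2 [])
odd-prime-factor {p ∷ ps} (p-prime ∷ primes) ¬all-2 with p ℕ.≟ 2
... | no p≢2 = p , ps , p-prime , p≢2 , primes , refl , refl
... | yes p≡2 with odd-prime-factor primes (λ all-2 → ¬all-2 (p≡2 ∷ all-2))
... | q , rest , q-prime , q≢2 , rest-primes , length≡ , product≡ =
  q , p ∷ rest , q-prime , q≢2 , p-prime ∷ rest-primes , cong suc length≡ ,
  trans (cong (p *_) product≡) (swap-factors p q (product rest))
  where
  swap-factors : ∀ a b c → a * (b * c) ≡ b * (a * c)
  swap-factors = solve-∀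

2*n≡2^k⇒ : ∀ n k → 2 * n ≡ 2 ^ k → 2 ≤ n → ∃[ t ] (1 ≤ t × n ≡ 2 ^ t)
2*n≡2^k⇒ n zero 2n≡1 2≤n =
  ⊥-elim (<⇒≢ (≤-trans (s≤s (s≤s z≤n)) (≤-trans 2≤n (m≤m+n n (n + 0)))) (sym 2n≡1))
2*n≡2^k⇒ n (suc k) 2n≡2^[1+k] 2≤n with *-cancelˡ-≡ n (2 ^ k) 2 2n≡2^[1+k]
2*n≡2^k⇒ n (suc zero) _ 2≤n | refl = ⊥-elim (<⇒≱ 2≤n ≤-refl)
2*n≡2^k⇒ n (suc (suc t)) _ _ | n≡2^[1+t] = suc t , s≤s z≤n , n≡2^[1+t]

-- The generalized quaternion group

module Quaternion (n-1 : ℕ) where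

  n N : ℕ
  n = suc n-1
  N = n + n

  G : Set
  G = QElem n

  _·_ : G → G → G
  _·_ = qMul n

  e : G
  e = qId n

  _∈⟨_⟩ : G → G → Set
  _∈⟨_⟩ = InCyclic _·_ e

  _^ᵍ_ : G → ℕ → G
  g ^ᵍ m = pow _·_ e g m

  Adj : G → G → Set
  Adj = QAdj n

  X Y : Fin N → G
  X i = i , false
  Y i = i , true

  x^ : ℕ → G
  x^ a = X (red n a)

  toℕ-red : ∀ a → toℕ (red n a) ≡ a % N
  toℕ-red a = toℕ-fromℕ< (m%n<n a N)

  red-≡ : ∀ a (j : Fin N) → a % N ≡ toℕ j → red n a ≡ j
  red-≡ a j eq = toℕ-injective (trans (toℕ-red a) eq)

  red-cong : ∀ a b → a % N ≡ b % N → red n a ≡ red n b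
  red-cong a b eq = toℕ-injective (trans (toℕ-red a) (trans eq (sym (toℕ-red b))))

  toℕ%N : ∀ (i : Fin N) → toℕ i % N ≡ toℕ i
  toℕ%N i = m<n⇒m%n≡m (toℕ<n i)

  n<N : n < N
  n<N = m<m+n n (s≤s z≤n)

  n∣N : n ∣ N
  n∣N = divides 2 (cong (n +_) (sym (+-identityʳ n)))

  2n≡N : 2 * n ≡ N
  2n≡N = cong (n +_) (+-identityʳ n)

  4n≡N+N : 4 * n ≡ N + N
  4n≡N+N = double-double n
    where
    double-double : ∀ m → 4 * m ≡ (m + m) + (m + m)
    double-double = solve-∀

  toℕ-red-0 : toℕ (red n 0) ≡ 0
  toℕ-red-0 = toℕ-red 0

  toℕ-red-n : toℕ (red n n) ≡ n
  toℕ-red-n = trans (toℕ-red n) (m<n⇒m%n≡m n<N)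

  toℕ≡0⇒X≡e : ∀ i → toℕ i ≡ 0 → X i ≡ e
  toℕ≡0⇒X≡e i eq = cong X (toℕ-injective (trans eq (sym toℕ-red-0)))

  +%N : ∀ a b → (a + b % N) % N ≡ (a + b) % N
  +%N a b = trans (%-distribˡ-+ a (b % N) N)
    (trans (cong (λ r → (a % N + r) % N) (m%n%n≡m%n b N)) (sym (%-distribˡ-+ a b N)))

  X^ : ∀ i m → X i ^ᵍ m ≡ x^ (toℕ i * m)
  X^ i zero = cong X (red-cong 0 (toℕ i * 0) (cong (_% N) (sym (*-zeroʳ (toℕ i)))))
  X^ i (suc m) = trans (cong (X i ·_) (X^ i m))
    (cong X (red-cong (toℕ i + toℕ (red n (toℕ i * m))) (toℕ i * suc m) exponent≡))
    where
    open ≡-Reasoning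
    exponent≡ : (toℕ i + toℕ (red n (toℕ i * m))) % N ≡ (toℕ i * suc m) % N
    exponent≡ = begin
      (toℕ i + toℕ (red n (toℕ i * m))) % N ≡⟨ cong (λ r → (toℕ i + r) % N) (toℕ-red (toℕ i * m)) ⟩
      (toℕ i + (toℕ i * m) % N) % N        ≡⟨ +%N (toℕ i) (toℕ i * m) ⟩
      (toℕ i + toℕ i * m) % N              ≡⟨ cong (_% N) (sym (*-suc (toℕ i) m)) ⟩
      (toℕ i * suc m) % N                  ∎

  xⁿ : G
  xⁿ = x^ n

  Y⁻ : Fin N → G
  Y⁻ i = Y (red n (toℕ i + n))

  Y·e : ∀ i → Y i · e ≡ Y i
  Y·e i = cong Y (red-≡ (toℕ i + (N ∸ toℕ (red n 0))) i (begin
    (toℕ i + (N ∸ toℕ (red n 0))) % N ≡⟨ cong (λ r → (toℕ i + (N ∸ r)) % N) toℕ-red-0 ⟩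
    (toℕ i + N) % N                    ≡⟨ [m+n]%n≡m%n (toℕ i) N ⟩
    toℕ i % N                          ≡⟨ toℕ%N i ⟩
    toℕ i                              ∎))
    where open ≡-Reasoning

  Y·Y : ∀ i → Y i · Y i ≡ xⁿ
  Y·Y i = cong X (red-cong (toℕ i + (N ∸ toℕ i) + n) n (begin
    (toℕ i + (N ∸ toℕ i) + n) % N ≡⟨ cong (λ r → (r + n) % N) (m+[n∸m]≡n (<⇒≤ (toℕ<n i))) ⟩
    (N + n) % N                    ≡⟨ cong (_% N) (+-comm N n) ⟩
    (n + N) % N                    ≡⟨ [m+n]%n≡m%n n N ⟩
    n % N                          ∎))
    where open ≡-Reasoning

  Y·xⁿ : ∀ i → Y i · xⁿ ≡ Y⁻ i
  Y·xⁿ i = cong (λ r → Y (red n (toℕ i + r))) (trans (cong (N ∸_) toℕ-red-n) (m+n∸m≡n n n))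

  Y·Y⁻ : ∀ i → Y i · Y⁻ i ≡ e
  Y·Y⁻ i = cong X (red-cong (toℕ i + (N ∸ j) + n) 0
    ([m+kn]≡[o+ln]⇒m%n≡o%n N (toℕ i + (N ∸ j) + n) 0 0 (suc q) (begin
      toℕ i + (N ∸ j) + n + 0      ≡⟨ +-identityʳ _ ⟩
      toℕ i + (N ∸ j) + n          ≡⟨ regroup (toℕ i) (N ∸ j) n ⟩
      (N ∸ j) + (toℕ i + n)        ≡⟨ cong ((N ∸ j) +_) (trans (m≡m%n+[m/n]*n (toℕ i + n) N)
                                        (cong (_+ q * N) (sym (toℕ-red (toℕ i + n))))) ⟩
      (N ∸ j) + (j + q * N)        ≡⟨ sym (+-assoc (N ∸ j) j (q * N)) ⟩
      (N ∸ j) + j + q * N          ≡⟨ cong (_+ q * N) (m∸n+n≡m (<⇒≤ (toℕ<n (red n (toℕ i + n))))) ⟩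
      N + q * N                    ∎)))
    where
    open ≡-Reasoning
    j q : ℕ
    j = toℕ (red n (toℕ i + n))
    q = (toℕ i + n) / N
    regroup : ∀ a b c → a + b + c ≡ b + (a + c)
    regroup = solve-∀

  PowerOfY : Fin N → G → Set
  PowerOfY i v = v ≡ e ⊎ v ≡ Y i ⊎ v ≡ xⁿ ⊎ v ≡ Y⁻ i

  Y^ : ∀ i m → PowerOfY i (Y i ^ᵍ m)
  Y^ i zero = inj₁ refl
  Y^ i (suc m) with Y^ i m
  ... | inj₁ eq = inj₂ (inj₁ (trans (cong (Y i ·_) eq) (Y·e i)))
  ... | inj₂ (inj₁ eq) = inj₂ (inj₂ (inj₁ (trans (cong (Y i ·_) eq) (Y·Y i))))
  ... | inj₂ (inj₂ (inj₁ eq)) = inj₂ (inj₂ (inj₂ (trans (cong (Y i ·_) eq) (Y·xⁿ i))))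
  ... | inj₂ (inj₂ (inj₂ eq)) = inj₁ (trans (cong (Y i ·_) eq) (Y·Y⁻ i))

  Y^2 : ∀ i → Y i ^ᵍ 2 ≡ xⁿ
  Y^2 i = trans (cong (Y i ·_) (Y·e i)) (Y·Y i)

  Y^3 : ∀ i → Y i ^ᵍ 3 ≡ Y⁻ i
  Y^3 i = trans (cong (Y i ·_) (Y^2 i)) (Y·xⁿ i)

  Y⁻⁻ : ∀ i → Y⁻ (red n (toℕ i + n)) ≡ Y i
  Y⁻⁻ i = cong Y (red-≡ (toℕ (red n (toℕ i + n)) + n) i (begin
    (toℕ (red n (toℕ i + n)) + n) % N ≡⟨ cong (λ r → (r + n) % N) (toℕ-red (toℕ i + n)) ⟩
    ((toℕ i + n) % N + n) % N        ≡⟨ cong (_% N) (+-comm ((toℕ i + n) % N) n) ⟩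
    (n + (toℕ i + n) % N) % N        ≡⟨ +%N n (toℕ i + n) ⟩
    (n + (toℕ i + n)) % N            ≡⟨ cong (_% N) (trans (+-comm n (toℕ i + n)) (+-assoc (toℕ i) n n)) ⟩
    (toℕ i + N) % N                  ≡⟨ [m+n]%n≡m%n (toℕ i) N ⟩
    toℕ i % N                        ≡⟨ toℕ%N i ⟩
    toℕ i                            ∎))
    where open ≡-Reasoning

  gcdN : Fin N → ℕ
  gcdN i = gcd (toℕ i) N

  Y∉⟨X⟩ : ∀ i j → ¬ Y j ∈⟨ X i ⟩
  Y∉⟨X⟩ i j (m , eq) with trans eq (X^ i m)
  ... | ()

  X∈⟨Y⟩⇒ : ∀ i j → X j ∈⟨ Y i ⟩ → X j ≡ e ⊎ X j ≡ xⁿ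
  X∈⟨Y⟩⇒ i j (m , eq) with Y^ i m
  ... | inj₁ p = inj₁ (trans eq p)
  ... | inj₂ (inj₂ (inj₁ p)) = inj₂ (trans eq p)
  ... | inj₂ (inj₁ p) with () ← trans eq p
  ... | inj₂ (inj₂ (inj₂ p)) with () ← trans eq p

  Y∈⟨Y⟩⇒ : ∀ i j → Y j ∈⟨ Y i ⟩ → Y j ≡ Y i ⊎ Y j ≡ Y⁻ i
  Y∈⟨Y⟩⇒ i j (m , eq) with Y^ i m
  ... | inj₂ (inj₁ p) = inj₁ (trans eq p)
  ... | inj₂ (inj₂ (inj₂ p)) = inj₂ (trans eq p)
  ... | inj₁ p with () ← trans eq p
  ... | inj₂ (inj₂ (inj₁ p)) with () ← trans eq p

  Y∈⟨Y⟩-sym : ∀ i j → Y j ∈⟨ Y i ⟩ → Y i ∈⟨ Y j ⟩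
  Y∈⟨Y⟩-sym i j Yj∈ with Y∈⟨Y⟩⇒ i j Yj∈
  ... | inj₁ p = 1 , trans (sym p) (sym (Y·e j))
  ... | inj₂ refl = 3 , trans (sym (Y⁻⁻ i)) (sym (Y^3 (red n (toℕ i + n))))

  X∈⟨X⟩⇒gcd∣ : ∀ i j → X j ∈⟨ X i ⟩ → gcdN i ∣ toℕ j
  X∈⟨X⟩⇒gcd∣ i j (m , eq) = subst (gcdN i ∣_) toℕ-j (multiple%⇒gcd∣ N (toℕ i) m)
    where
    toℕ-j : (toℕ i * m) % N ≡ toℕ j
    toℕ-j = sym (trans (cong (λ v → toℕ (proj₁ v)) (trans eq (X^ i m))) (toℕ-red (toℕ i * m)))

  gcd∣⇒X∈⟨X⟩ : ∀ i j → gcdN i ∣ toℕ j → X j ∈⟨ X i ⟩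
  gcd∣⇒X∈⟨X⟩ i j gcd∣ with gcd∣⇒multiple% (n-1 + n) (toℕ i) (toℕ j) gcd∣ (toℕ<n j)
  ... | m , eq = m , trans (cong X (sym (red-≡ (toℕ i * m) j (sym eq)))) (sym (X^ i m))

  _≟_ : DecidableEquality G
  _≟_ = ≡-dec Fin._≟_ Bool._≟_

  _∈⟨_⟩? : ∀ h g → Dec (h ∈⟨ g ⟩)
  (j , false) ∈⟨ i , false ⟩? = map′ (gcd∣⇒X∈⟨X⟩ i j) (X∈⟨X⟩⇒gcd∣ i j) (gcdN i ∣? toℕ j)
  (j , true) ∈⟨ i , false ⟩? = no (Y∉⟨X⟩ i j)
  (j , false) ∈⟨ i , true ⟩? with X j ≟ e | X j ≟ xⁿ
  ... | yes p | _ = yes (0 , p)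
  ... | no _ | yes p = yes (2 , trans p (sym (Y^2 i)))
  ... | no ≢e | no ≢xⁿ = no (λ Xj∈ → [ ≢e , ≢xⁿ ] (X∈⟨Y⟩⇒ i j Xj∈))
  (j , true) ∈⟨ i , true ⟩? with Y j ≟ Y i | Y j ≟ Y⁻ i
  ... | yes p | _ = yes (1 , trans p (sym (Y·e i)))
  ... | no _ | yes p = yes (3 , trans p (sym (Y^3 i)))
  ... | no ≢Yi | no ≢Y⁻i = no (λ Yj∈ → [ ≢Yi , ≢Y⁻i ] (Y∈⟨Y⟩⇒ i j Yj∈))

  Adj? : ∀ u v → Dec (Adj u v)
  Adj? u v = ¬? (u ≟ v) ×-dec ((u ∈⟨ v ⟩? ×-dec ¬? (v ∈⟨ u ⟩?)) ⊎-dec (v ∈⟨ u ⟩? ×-dec ¬? (u ∈⟨ v ⟩?)))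

  Adj-sym : Symmetric Adj
  Adj-sym (u≢v , proper) = ≢-sym u≢v , swap proper

  properCyclic⇒Adj : ∀ {g h} → ProperCyclic _·_ e g h → Adj g h
  properCyclic⇒Adj (g∈ , h∉) = (λ { refl → h∉ g∈ }) , inj₁ (g∈ , h∉)

  ∉⟨e⟩ : ∀ v → v ≢ e → ¬ v ∈⟨ e ⟩
  ∉⟨e⟩ (i , true) _ = Y∉⟨X⟩ (red n 0) i
  ∉⟨e⟩ (i , false) v≢e v∈ = v≢e (toℕ≡0⇒X≡e i (∣∧<⇒≡0 N∣i (toℕ<n i)))
    where
    N∣i : N ∣ toℕ i
    N∣i = subst (_∣ toℕ i) (cong (λ r → gcd r N) toℕ-red-0) (X∈⟨X⟩⇒gcd∣ (red n 0) i v∈)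

  e-adj : ∀ v → v ≢ e → Adj e v
  e-adj v v≢e = properCyclic⇒Adj ((0 , refl) , ∉⟨e⟩ v v≢e)

  ¬Adj-YY : ∀ i j → ¬ Adj (Y i) (Y j)
  ¬Adj-YY i j (_ , inj₁ (Yi∈ , Yj∉)) = Yj∉ (Y∈⟨Y⟩-sym j i Yi∈)
  ¬Adj-YY i j (_ , inj₂ (Yj∈ , Yi∉)) = Yi∉ (Y∈⟨Y⟩-sym i j Yj∈)

  Adj-XY⇒ : ∀ i j → Adj (X j) (Y i) → X j ≡ e ⊎ X j ≡ xⁿ
  Adj-XY⇒ i j (_ , inj₁ (Xj∈ , _)) = X∈⟨Y⟩⇒ i j Xj∈
  Adj-XY⇒ i j (_ , inj₂ (Yi∈ , _)) = ⊥-elim (Y∉⟨X⟩ j i Yi∈)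

  xⁿ-adj-Y : ∀ i → Adj xⁿ (Y i)
  xⁿ-adj-Y i = properCyclic⇒Adj ((2 , sym (Y^2 i)) , Y∉⟨X⟩ (red n n) i)

  elements : List G
  elements = map X (allFin N) ++ map Y (allFin N)

  ∈-elements : ∀ v → v ∈ elements
  ∈-elements (i , false) = ∈-++⁺ˡ (∈-map⁺ X (∈-allFin i))
  ∈-elements (i , true) = ∈-++⁺ʳ (map X (allFin N)) (∈-map⁺ Y (∈-allFin i))

  elements-unique : Unique elements
  elements-unique = Unique.++⁺ (Unique.map⁺ (cong proj₁) (Unique.allFin⁺ N))
    (Unique.map⁺ (cong proj₁) (Unique.allFin⁺ N)) disjoint
    where
    disjoint : ∀ {v} → ¬ (v ∈ map X (allFin N) × v ∈ map Y (allFin N))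
    disjoint (v∈X , v∈Y) with ∈-map⁻ X v∈X | ∈-map⁻ Y v∈Y
    ... | _ , _ , refl | _ , _ , ()

  length-elements : length elements ≡ N + N
  length-elements = trans (length-++ (map X (allFin N)))
    (cong₂ _+_ (trans (length-map X (allFin N)) (length-tabulate (λ i → i)))
               (trans (length-map Y (allFin N)) (length-tabulate (λ i → i))))

  open UniversalVertex Adj _≟_ Adj? Adj-sym e e-adj public
  open Complement elements elements-unique ∈-elements public

  gcdN∣N : ∀ i → gcdN i ∣ N
  gcdN∣N i = gcd[m,n]∣n (toℕ i) N

  gcdN-e : gcdN (red n 0) ≡ N
  gcdN-e = cong (λ r → gcd r N) toℕ-red-0

  gcdN-xⁿ : gcdN (red n n) ≡ n
  gcdN-xⁿ = trans (cong (λ r → gcd r N) (toℕ-red n)) (gcd[d%N,N]≡d N n n∣N)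

  xⁿ≢e : xⁿ ≢ e
  xⁿ≢e xⁿ≡e = <⇒≢ (s≤s z≤n) (trans (sym toℕ-red-0) (trans (cong (λ v → toℕ (proj₁ v)) (sym xⁿ≡e)) toℕ-red-n))

  N∤gcdN : ∀ i → X i ≢ e → ¬ N ∣ gcdN i
  N∤gcdN i Xi≢e N∣ = Xi≢e (toℕ≡0⇒X≡e i (∣∧<⇒≡0 (∣-trans N∣ (gcd[m,n]∣m (toℕ i) N)) (toℕ<n i)))

  X∉⟨xⁿ⟩ : ∀ j → X j ≢ e → X j ≢ xⁿ → ¬ X j ∈⟨ xⁿ ⟩
  X∉⟨xⁿ⟩ j Xj≢e Xj≢xⁿ Xj∈ = Xj≢xⁿ (cong X (toℕ-injective (trans j≡n (sym toℕ-red-n))))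
    where
    n∣j : n ∣ toℕ j
    n∣j = subst (_∣ toℕ j) gcdN-xⁿ (X∈⟨X⟩⇒gcd∣ (red n n) j Xj∈)
    j≡n : toℕ j ≡ n
    j≡n with n∣j
    ... | divides 0 j≡0 = ⊥-elim (Xj≢e (toℕ≡0⇒X≡e j j≡0))
    ... | divides 1 j≡n = trans j≡n (+-identityʳ n)
    ... | divides (suc (suc q)) j≡ = ⊥-elim (<⇒≱ (subst (_< N) j≡ (toℕ<n j)) (+-monoʳ-≤ n (m≤m+n n (q * n))))

-- Strong resolving sets of P_R(Q_4n)

module DivisorChain (n-1 : ℕ) where

  open Quaternion n-1
  open import Data.List.Membership.DecPropositional _≟_ using (_∈?_)

  gcdN-x^ : ∀ d → d ∣ N → gcdN (red n d) ≡ d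
  gcdN-x^ d d∣N = trans (cong (λ r → gcd r N) (toℕ-red d)) (gcd[d%N,N]≡d N d d∣N)

  gcdN-x^[N∸d] : ∀ d → d ∣ N → d ≤ N → gcdN (red n (N ∸ d)) ≡ d
  gcdN-x^[N∸d] d d∣N d≤N = trans (cong (λ r → gcd r N) (toℕ-red (N ∸ d))) (gcd[[N∸d]%N,N]≡d N d d∣N d≤N)

  ∣N⇒0< : ∀ {d} → d ∣ N → 0 < d
  ∣N⇒0< {zero} 0∣N with () ← 0∣⇒≡0 0∣N
  ∣N⇒0< {suc d} _ = s≤s z≤n

  -- x^(N ∸ d') generates the same subgroup as x^d', so it sees x^d but not x^d';
  -- the two differ unless 2 d' = N.
  x^-separated : ∀ d d' → d ∣ N → d' ∣ N → d' ∣ d → d' ≢ d → d' + d' ≢ N →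
    Adj (x^ d) (x^ d') × Separates (x^ (N ∸ d')) (x^ d) (x^ d')
  x^-separated d d' d∣N d'∣N d'∣d d'≢d 2d'≢N =
    properCyclic⇒Adj (x^d∈⟨x^d'⟩ , x^d'∉⟨x^d⟩) ,
    Adj-sym (properCyclic⇒Adj (x^d∈⟨w⟩ , w∉⟨x^d⟩)) , ¬Adj-w-x^d' , w≢x^d'
    where
    i j k : Fin N
    i = red n d
    j = red n d'
    k = red n (N ∸ d')
    d'<N : d' < N
    d'<N = <-≤-trans (≤∧≢⇒< (∣⇒≤ {{>-nonZero (∣N⇒0< d∣N)}} d'∣d) d'≢d) (∣⇒≤ d∣N)
    gcd-i : gcdN i ≡ d
    gcd-i = gcdN-x^ d d∣N
    gcd-j : gcdN j ≡ d'
    gcd-j = gcdN-x^ d' d'∣N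
    gcd-k : gcdN k ≡ d'
    gcd-k = gcdN-x^[N∸d] d' d'∣N (<⇒≤ d'<N)
    d∤d' : ¬ d ∣ d'
    d∤d' d∣d' = d'≢d (∣-antisym d'∣d d∣d')
    toℕ-i : toℕ i ≡ d % N
    toℕ-i = toℕ-red d
    toℕ-j : toℕ j ≡ d'
    toℕ-j = trans (toℕ-red d') (m<n⇒m%n≡m d'<N)
    toℕ-k : toℕ k ≡ N ∸ d'
    toℕ-k = trans (toℕ-red (N ∸ d')) (m<n⇒m%n≡m (∸-monoʳ-< {N} {d'} {0} (∣N⇒0< d'∣N) (<⇒≤ d'<N)))
    d'∣d%N : d' ∣ toℕ i
    d'∣d%N = subst (d' ∣_) (sym toℕ-i) (%-presˡ-∣ d'∣d d'∣N)
    x^d∈⟨x^d'⟩ : x^ d ∈⟨ x^ d' ⟩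
    x^d∈⟨x^d'⟩ = gcd∣⇒X∈⟨X⟩ j i (subst (_∣ toℕ i) (sym gcd-j) d'∣d%N)
    x^d'∉⟨x^d⟩ : ¬ x^ d' ∈⟨ x^ d ⟩
    x^d'∉⟨x^d⟩ x^d'∈ = d∤d' (subst₂ _∣_ gcd-i toℕ-j (X∈⟨X⟩⇒gcd∣ i j x^d'∈))
    x^d∈⟨w⟩ : x^ d ∈⟨ x^ (N ∸ d') ⟩
    x^d∈⟨w⟩ = gcd∣⇒X∈⟨X⟩ k i (subst (_∣ toℕ i) (sym gcd-k) d'∣d%N)
    w∉⟨x^d⟩ : ¬ x^ (N ∸ d') ∈⟨ x^ d ⟩
    w∉⟨x^d⟩ w∈ = d∤d' (∣m+n∣m⇒∣n (subst (d ∣_) (sym (m∸n+n≡m (<⇒≤ d'<N))) d∣N)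
      (subst (d ∣_) toℕ-k (subst (_∣ toℕ k) gcd-i (X∈⟨X⟩⇒gcd∣ i k w∈))))
    ¬Adj-w-x^d' : ¬ Adj (x^ (N ∸ d')) (x^ d')
    ¬Adj-w-x^d' (_ , inj₁ (_ , x^d'∉)) = x^d'∉ (gcd∣⇒X∈⟨X⟩ k j (subst₂ _∣_ (sym gcd-k) (sym toℕ-j) ∣-refl))
    ¬Adj-w-x^d' (_ , inj₂ (_ , w∉)) =
      w∉ (gcd∣⇒X∈⟨X⟩ j k (subst₂ _∣_ (sym gcd-j) (sym toℕ-k) (∣N⇒∣N∸d (<⇒≤ d'<N) d'∣N ∣-refl)))
    w≢x^d' : x^ (N ∸ d') ≢ x^ d'
    w≢x^d' w≡ = 2d'≢N (trans (cong (_+ d') d'≡N∸d') (m∸n+n≡m (<⇒≤ d'<N)))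
      where
      d'≡N∸d' : d' ≡ N ∸ d'
      d'≡N∸d' = trans (sym toℕ-j) (trans (cong (λ v → toℕ (proj₁ v)) (sym w≡)) toℕ-k)

  divisorChain-resolving : ∀ L (Ds : List ℕ) → length Ds ≡ suc L → Unique Ds → (∀ {d} → d ∈ Ds → d ∣ N) →
    (∀ {d d'} → d ∈ Ds → d' ∈ Ds → d ∣ d' ⊎ d' ∣ d) →
    (∀ {d d'} → d ∈ Ds → d' ∈ Ds → d' ∣ d → d' ≢ d → d' + d' ≢ N) →
    ∃[ S ] (Unique S × IsStrongResolvingSet Adj S × length S ≡ N + N ∸ suc L)
  divisorChain-resolving L Ds length-Ds unique ∣N comparable 2d'≢N =
    complement C , complement-unique C , complement-resolving C separated , length-S
    where
    C : List G
    C = map x^ Ds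
    x^-injective : ∀ {a b} → a ∈ Ds → b ∈ Ds → x^ a ≡ x^ b → a ≡ b
    x^-injective {a} {b} a∈ b∈ eq =
      trans (sym (gcdN-x^ a (∣N a∈))) (trans (cong (λ v → gcdN (proj₁ v)) eq) (gcdN-x^ b (∣N b∈)))
    separate : ∀ {d d'} → d ∈ Ds → d' ∈ Ds → d' ∣ d → x^ d ≢ x^ d' →
      Adj (x^ d) (x^ d') × Separates (x^ (N ∸ d')) (x^ d) (x^ d')
    separate {d} {d'} d∈ d'∈ d'∣d x^d≢x^d' =
      x^-separated d d' (∣N d∈) (∣N d'∈) d'∣d d'≢d (2d'≢N d∈ d'∈ d'∣d d'≢d)
      where
      d'≢d : d' ≢ d
      d'≢d refl = x^d≢x^d' refl
    separated : ∀ {a b} → a ∈ C → b ∈ C → a ≢ b →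
      Adj a b × (∃[ w ] Separates w a b ⊎ ∃[ w ] Separates w b a)
    separated a∈ b∈ a≢b with ∈-map⁻ x^ a∈ | ∈-map⁻ x^ b∈
    ... | d , d∈ , refl | d' , d'∈ , refl with comparable d∈ d'∈
    ... | inj₂ d'∣d = let adj , sep = separate d∈ d'∈ d'∣d a≢b in adj , inj₁ (_ , sep)
    ... | inj₁ d∣d' = let adj , sep = separate d'∈ d∈ d∣d' (≢-sym a≢b) in Adj-sym adj , inj₂ (_ , sep)
    length-S : length (complement C) ≡ N + N ∸ suc L
    length-S = begin
      length (complement C)                       ≡⟨ sym (m+n∸n≡m (length (complement C)) (length C)) ⟩
      length (complement C) + length C ∸ length C ≡⟨ cong₂ _∸_ length-total (trans (length-map x^ Ds) length-Ds) ⟩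
      N + N ∸ suc L                               ∎
      where
      open ≡-Reasoning
      length-total : length (complement C) + length C ≡ N + N
      length-total = trans (length-complement C (unique-map⁺ unique x^-injective)) length-elements


-- ⟨x^i⟩ = ⟨x^gcd(i,2n)⟩, so a proper inclusion of cyclic subgroups of ⟨x⟩ makes the
-- gcd a proper divisor and lowers its number of prime factors.
module Labelling (n-1 : ℕ) (ps : List ℕ) (primes : All Prime ps)
    (product≡N : product ps ≡ Quaternion.N n-1) (2≤n : 2 ≤ Quaternion.n n-1) where

  open Quaternion n-1

  label : G → ℕ
  label (i , false) = primeCount ps (gcdN i)
  label (_ , true) = 0

  ∣N⇒∣product : ∀ {d} → d ∣ N → d ∣ product ps
  ∣N⇒∣product {d} = subst (d ∣_) (sym product≡N)

  label-properCyclic : ∀ {i j} → ProperCyclic _·_ e (X i) (X j) → label (X j) < label (X i)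
  label-properCyclic {i} {j} (Xi∈ , Xj∉) = primeCount-< primes
    (gcd-greatest (X∈⟨X⟩⇒gcd∣ j i Xi∈) (gcdN∣N j))
    (λ gcd∣ → Xj∉ (gcd∣⇒X∈⟨X⟩ i j (∣-trans gcd∣ (gcd[m,n]∣m (toℕ j) N))))
    (∣N⇒∣product (gcdN∣N i))

  0<primeCount : ∀ {d} → d ∣ N → 2 ≤ d → 0 < primeCount ps d
  0<primeCount {d} d∣N 2≤d = ≤-trans (s≤s z≤n)
    (primeCount-< primes (1∣ d) (λ d∣1 → <⇒≢ 2≤d (sym (∣1⇒≡1 d∣1))) (∣N⇒∣product d∣N))

  0<label : ∀ {i} → X i ≡ e ⊎ X i ≡ xⁿ → 0 < label (X i)
  0<label (inj₁ refl) = subst (λ d → 0 < primeCount ps d) (sym gcdN-e) (0<primeCount ∣-refl (≤-trans 2≤n (m≤m+n n n)))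
  0<label (inj₂ refl) = subst (λ d → 0 < primeCount ps d) (sym gcdN-xⁿ) (0<primeCount n∣N 2≤n)

  label-adjacent-≢ : ∀ {a b} → Adj a b → label a ≢ label b
  label-adjacent-≢ {i , false} {j , false} (_ , inj₁ proper) eq = <⇒≢ (label-properCyclic proper) (sym eq)
  label-adjacent-≢ {i , false} {j , false} (_ , inj₂ proper) eq = <⇒≢ (label-properCyclic proper) eq
  label-adjacent-≢ {i , false} {j , true} adj eq = <⇒≢ (0<label (Adj-XY⇒ j i adj)) (sym eq)
  label-adjacent-≢ {i , true} {j , false} adj eq = <⇒≢ (0<label (Adj-XY⇒ i j (Adj-sym adj))) eq
  label-adjacent-≢ {i , true} {j , true} adj _ = ¬Adj-YY i j adj

  label-≤ : ∀ v → label v ≤ length ps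
  label-≤ (i , false) = primeCount-≤-length primes (∣N⇒∣product (gcdN∣N i))
  label-≤ (_ , true) = z≤n

  primeCount<length : ∀ {d} → d ∣ N → ¬ N ∣ d → primeCount ps d < length ps
  primeCount<length {d} d∣N N∤d = subst (primeCount ps d <_)
    (trans (cong (primeCount ps) (sym product≡N)) (primeCount-product primes))
    (primeCount-< primes d∣N N∤d (∣N⇒∣product ∣-refl))

  label-< : ∀ v → v ≢ e → label v < length ps
  label-< (i , false) Xi≢e = primeCount<length (gcdN∣N i) (N∤gcdN i Xi≢e)
  label-< (_ , true) _ = ≤-trans (s≤s z≤n)
    (primeCount<length (1∣ N) (λ N∣1 → <⇒≢ (≤-<-trans (s≤s z≤n) n<N) (sym (∣1⇒≡1 N∣1))))

  resolving-length-≥ : ∀ S → Unique S → IsStrongResolvingSet Adj S → N + N ≤ suc (length ps) + length S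
  resolving-length-≥ S uniqueS resolving = subst (_≤ suc (length ps) + length S) length-elements
    (length-vertices-≤ S (length ps) label uniqueS label-≤
      (λ a∉ b∉ a≢b → label-adjacent-≢ (outside-adjacent a∉ b∉ a≢b)))
    where open ResolvingSet S resolving

module PowerOfTwo (n-1 t : ℕ) (n≡2^t : Quaternion.n n-1 ≡ 2 ^ t) (2≤n : 2 ≤ Quaternion.n n-1) where

  open Quaternion n-1
  open DivisorChain n-1

  N≡2^[1+t] : N ≡ 2 ^ suc t
  N≡2^[1+t] = trans (cong (λ m → m + m) n≡2^t) (cong (2 ^ t +_) (sym (+-identityʳ (2 ^ t))))

  gcdN∣n : ∀ j → X j ≢ e → gcdN j ∣ n
  gcdN∣n j Xj≢e = subst (gcdN j ∣_) (sym n≡2^t) (∣p^[1+t]⇒∣p^t t prime[2]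
    (subst (gcdN j ∣_) N≡2^[1+t] (gcdN∣N j))
    (λ gcd≡ → N∤gcdN j Xj≢e (subst (_∣ gcdN j) (sym (trans N≡2^[1+t] (sym gcd≡))) ∣-refl)))

  xⁿ∈⟨X⟩ : ∀ j → X j ≢ e → xⁿ ∈⟨ X j ⟩
  xⁿ∈⟨X⟩ j Xj≢e = gcd∣⇒X∈⟨X⟩ j (red n n) (subst (gcdN j ∣_) (sym toℕ-red-n) (gcdN∣n j Xj≢e))

  -- In a 2-group the unique involution xⁿ lies in every non-trivial cyclic subgroup.
  xⁿ-adj : ∀ v → v ≢ e → v ≢ xⁿ → Adj xⁿ v
  xⁿ-adj (i , true) _ _ = xⁿ-adj-Y i
  xⁿ-adj (j , false) Xj≢e Xj≢xⁿ = properCyclic⇒Adj (xⁿ∈⟨X⟩ j Xj≢e , X∉⟨xⁿ⟩ j Xj≢e Xj≢xⁿ)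

  twin-e-xⁿ : Twin e xⁿ
  twin-e-xⁿ w _ with w ≟ e
  ... | yes w≡e = inj₁ w≡e
  ... | no w≢e = inj₂ (Adj-sym (e-adj w w≢e))

  twin-xⁿ-e : Twin xⁿ e
  twin-xⁿ-e w w-adj-e with w ≟ xⁿ
  ... | yes w≡xⁿ = inj₁ w≡xⁿ
  ... | no w≢xⁿ = inj₂ (Adj-sym (xⁿ-adj w (λ { refl → proj₁ w-adj-e refl }) w≢xⁿ))

  -- Identifies the twins e and xⁿ, at most one of which lies outside a strong resolving set.
  collapse : G → G
  collapse v with v ≟ e
  ... | yes _ = xⁿ
  ... | no _ = v

  collapse≢e : ∀ v → collapse v ≢ e
  collapse≢e v with v ≟ e
  ... | yes _ = xⁿ≢e
  ... | no v≢e = v≢e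

  module _ (S : List G) (resolving : IsStrongResolvingSet Adj S) where

    open ResolvingSet S resolving

    collapse-adjacent : ∀ {a b} → a ∉ S → b ∉ S → a ≢ b → Adj (collapse a) (collapse b)
    collapse-adjacent {a} {b} a∉ b∉ a≢b with a ≟ e | b ≟ e
    ... | yes refl | yes refl = ⊥-elim (a≢b refl)
    ... | yes refl | no b≢e = xⁿ-adj b b≢e (λ { refl → outside-¬twins a∉ b∉ a≢b twin-e-xⁿ twin-xⁿ-e })
    ... | no a≢e | yes refl = Adj-sym (xⁿ-adj a a≢e (λ { refl → outside-¬twins b∉ a∉ (≢-sym a≢b) twin-e-xⁿ twin-xⁿ-e }))
    ... | no _ | no _ = outside-adjacent a∉ b∉ a≢b

  open Labelling n-1 (replicate (suc t) 2) (All.replicate⁺ (suc t) prime[2])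
    (trans (product-replicate (suc t) 2) (sym N≡2^[1+t])) 2≤n
    using (label; label-<; label-adjacent-≢)

  label-collapse-≤ : ∀ v → label (collapse v) ≤ t
  label-collapse-≤ v = ≤-pred (subst (label (collapse v) <_) (length-replicate (suc t))
    (label-< (collapse v) (collapse≢e v)))

  resolving-length-≥ : ∀ S → Unique S → IsStrongResolvingSet Adj S → N + N ≤ suc t + length S
  resolving-length-≥ S uniqueS resolving = subst (_≤ suc t + length S) length-elements
    (length-vertices-≤ S t (label ∘ collapse) uniqueS label-collapse-≤
      (λ a∉ b∉ a≢b → label-adjacent-≢ (collapse-adjacent S resolving a∉ b∉ a≢b)))

  divisors : List ℕ
  divisors = suffixProducts (replicate t 2)

  divisor∣n : ∀ {d} → d ∈ divisors → d ∣ n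
  divisor∣n {d} d∈ = subst (d ∣_) (trans (product-replicate t 2) (sym n≡2^t)) (suffixProducts-∣ (replicate t 2) d∈)

  2d'≢N : ∀ {d d'} → d ∈ divisors → d' ∈ divisors → d' ∣ d → d' ≢ d → d' + d' ≢ N
  2d'≢N {d} {d'} d∈ _ d'∣d d'≢d = <⇒≢ (+-mono-< d'<n d'<n)
    where
    d'<n : d' < n
    d'<n = <-≤-trans (≤∧≢⇒< (∣⇒≤ {{>-nonZero (∣N⇒0< (∣-trans (divisor∣n d∈) n∣N))}} d'∣d) d'≢d)
      (∣⇒≤ (divisor∣n d∈))

  2^[t+2]≡N+N : 2 ^ (t + 2) ≡ N + N
  2^[t+2]≡N+N = begin
    2 ^ (t + 2)      ≡⟨ cong (2 ^_) (+-comm t 2) ⟩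
    2 * (2 * 2 ^ t)  ≡⟨ cong (λ m → 2 * (2 * m)) (sym n≡2^t) ⟩
    2 * (2 * n)      ≡⟨ *-assoc 2 2 n ⟨
    4 * n            ≡⟨ 4n≡N+N ⟩
    N + N            ∎
    where open ≡-Reasoning

  chain-complement : ∃[ S ] (Unique S × IsStrongResolvingSet Adj S × length S ≡ N + N ∸ suc t)
  chain-complement = divisorChain-resolving t divisors
    (trans (length-suffixProducts (replicate t 2)) (cong suc (length-replicate t)))
    (suffixProducts-unique (All.replicate⁺ t prime[2])) (λ d∈ → ∣-trans (divisor∣n d∈) n∣N)
    (suffixProducts-comparable (replicate t 2)) 2d'≢N

  sdim : SDimIs Adj (2 ^ (t + 2) ∸ t ∸ 1)
  sdim = subst (λ M → SDimIs Adj (M ∸ t ∸ 1)) (sym 2^[t+2]≡N+N)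
    (SDimIs-intro (N + N) t chain-complement resolving-length-≥)

module OddPrimeFactor (n-1 q : ℕ) (rest : List ℕ) (q-prime : Prime q) (q≢2 : q ≢ 2) (rest-primes : All Prime rest)
    (product≡N : q * product rest ≡ Quaternion.N n-1) (2≤n : 2 ≤ Quaternion.n n-1) where

  open Quaternion n-1
  open DivisorChain n-1
  open Labelling n-1 (q ∷ rest) (q-prime ∷ rest-primes) product≡N 2≤n using (resolving-length-≥)

  R : ℕ
  R = product rest

  divisors : List ℕ
  divisors = suffixProducts (q ∷ rest)

  -- Every divisor below the top one divides R ≤ N / 3.
  2d'≢N : ∀ {d d'} → d ∈ divisors → d' ∈ divisors → d' ∣ d → d' ≢ d → d' + d' ≢ N
  2d'≢N d∈ (here refl) d'∣d d'≢d _ = d'≢d (∣-antisym d'∣d (suffixProducts-∣ (q ∷ rest) d∈))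
  2d'≢N {d} {d'} _ (there d'∈) _ _ = <⇒≢ (begin-strict
    d' + d'     ≤⟨ +-mono-≤ d'≤R d'≤R ⟩
    R + R       <⟨ m<m+n (R + R) 0<R ⟩
    R + R + R   ≡⟨ regroup R ⟩
    3 * R       ≤⟨ *-monoˡ-≤ R 3≤q ⟩
    q * R       ≡⟨ product≡N ⟩
    N           ∎)
    where
    open ≤-Reasoning
    instance
      _ : NonZero R
      _ = productOfPrimes≢0 rest-primes
    0<R : 0 < R
    0<R = >-nonZero⁻¹ R
    d'≤R : d' ≤ R
    d'≤R = ∣⇒≤ (suffixProducts-∣ rest d'∈)
    3≤q : 3 ≤ q
    3≤q = ≤∧≢⇒< (nonTrivial⇒n>1 q {{prime⇒nonTrivial q-prime}}) (≢-sym q≢2)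
    regroup : ∀ R → R + R + R ≡ 3 * R
    regroup = solve-∀

  chain-complement : ∃[ S ] (Unique S × IsStrongResolvingSet Adj S × length S ≡ N + N ∸ suc (suc (length rest)))
  chain-complement = divisorChain-resolving (suc (length rest)) divisors (length-suffixProducts (q ∷ rest))
    (suffixProducts-unique (q-prime ∷ rest-primes))
    (λ {d} d∈ → subst (d ∣_) product≡N (suffixProducts-∣ (q ∷ rest) d∈))
    (suffixProducts-comparable (q ∷ rest)) 2d'≢N

  sdim : SDimIs Adj (4 * n ∸ suc (length rest) ∸ 1)
  sdim = subst (λ M → SDimIs Adj (M ∸ suc (length rest) ∸ 1)) (sym 4n≡N+N)
    (SDimIs-intro (N + N) (suc (length rest)) chain-complement resolving-length-≥)

corollary5p6 : (n : ℕ) → .{{_ : NonZero n}} → 2 ≤ n →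
    (∀ (t : ℕ) → 1 ≤ t → n ≡ 2 ^ t → SDimIs (QAdj n) (2 ^ (t + 2) ∸ t ∸ 1))
    × (¬ (∃[ t ] (1 ≤ t × n ≡ 2 ^ t)) →
       ∀ (k : ℕ) → OmegaIs (2 * n) k → SDimIs (QAdj n) (4 * n ∸ k ∸ 1))
corollary5p6 (suc n-1) 2≤n = power-of-two , not-power-of-two
  where
  open Quaternion n-1 using (n; 2n≡N)

  power-of-two : ∀ t → 1 ≤ t → n ≡ 2 ^ t → SDimIs (QAdj n) (2 ^ (t + 2) ∸ t ∸ 1)
  power-of-two t _ n≡2^t = PowerOfTwo.sdim n-1 t n≡2^t 2≤n

  not-power-of-two : ¬ (∃[ t ] (1 ≤ t × n ≡ 2 ^ t)) → ∀ k → OmegaIs (2 * n) k → SDimIs (QAdj n) (4 * n ∸ k ∸ 1)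
  not-power-of-two ¬power k (ps , primes , refl , product≡2n) with All.all? (ℕ._≟ 2) ps
  ... | yes all-2 =
    ⊥-elim (¬power (2*n≡2^k⇒ n (length ps) (trans (sym product≡2n) (all≡2⇒product≡2^length all-2)) 2≤n))
  ... | no ¬all-2 with odd-prime-factor primes ¬all-2
  ... | q , rest , q-prime , q≢2 , rest-primes , length≡ , product≡ =
    subst (λ k → SDimIs (QAdj n) (4 * n ∸ k ∸ 1)) (sym length≡)
      (OddPrimeFactor.sdim n-1 q rest q-prime q≢2 rest-primes (trans (sym product≡) (trans product≡2n 2n≡N)) 2≤n)
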